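{- For all integers $0\le r\le n$, the lattices $S(n,r)$ and $S(n,n-r)$ are isomorphic.
   Context: For integers $0\le r\le n$, $A(n,r)$ is an alphabet of $n+1$ formal symbols $\tilde 1,\dots,\tilde r,\ 0^\S,\ \bar 1,\dots,\overline{n-r}$, totally ordered by $\overline{n-r}\prec\cdots\prec\bar1\prec 0^\S\prec\tilde1\prec\cdots\prec\tilde r$. $S(n,r)$ is the set of strings $w=i_1\cdots i_r\,|\,j_1\cdots j_{n-r}$ with $i_k\in\{\tilde1,\dots,\tilde r,0^\S\}$, $j_k\in\{0^\S,\bar1,\dots,\overline{n-r}\}$ such that for some $0\le p\le r$, $1\le q\le n-r+1$: $i_1\succ\cdots\succ i_p\succ 0^\S=i_{p+1}=\cdots=i_r$ and $j_1=\cdots=j_{q-1}=0^\S\succ j_q\succ\cdots\succ j_{n-r}$, ordered componentwise by $\preceq$. -}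

module Defs where

open import Data.Nat using (ℕ; _∸_)
import Data.Nat as ℕ
open import Data.Integer using (ℤ; +_; -_; 0ℤ; _≤_; _<_)
open import Data.Fin using (Fin; toℕ)
open import Data.Vec using (Vec; lookup)
open import Data.Product using (Σ; _×_; ∃)
open import Relation.Binary.PropositionalEquality using (_≡_)
open import Relation.Binary.Morphism.Structures using (IsOrderIsomorphism)

-- Encoding of the alphabet A(n,r) into ℤ:
--   tilde k ↦ + k,   0^§ ↦ 0,   bar k ↦ - (+ k).
-- The total order ≺ on A(n,r) becomes the usual order on ℤ.

-- Left block i_1 ... i_r : letters from {0^§, tilde 1, ..., tilde r},
-- i.e. integers in [0, r]; there is p ≤ r with
-- i_1 ≻ ... ≻ i_p ≻ 0^§ = i_{p+1} = ... = i_r.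
-- (Indices are 0-based: positions k < p are the strictly decreasing positive part.)
LeftOK : (r : ℕ) → Vec ℤ r → Set
LeftOK r i =
  (∀ (k : Fin r) → (0ℤ ≤ lookup i k) × (lookup i k ≤ + r)) ×
  Σ ℕ (λ p → (p ℕ.≤ r) ×
    ((∀ (k : Fin r) → toℕ k ℕ.< p → 0ℤ < lookup i k) ×
     ((∀ (k l : Fin r) → toℕ k ℕ.< toℕ l → toℕ l ℕ.< p → lookup i l < lookup i k) ×
      (∀ (k : Fin r) → p ℕ.≤ toℕ k → lookup i k ≡ 0ℤ))))

-- Right block j_1 ... j_m (m = n - r): letters from {0^§, bar 1, ..., bar m},
-- i.e. integers in [-m, 0]; there is q with 1 ≤ q ≤ m+1 and
-- j_1 = ... = j_{q-1} = 0^§ ≻ j_q ≻ ... ≻ j_m.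
-- We write q' = q - 1 ∈ [0, m] (0-based): positions k < q' are 0,
-- positions k ≥ q' are negative and strictly decreasing.
RightOK : (m : ℕ) → Vec ℤ m → Set
RightOK m j =
  (∀ (k : Fin m) → (- (+ m) ≤ lookup j k) × (lookup j k ≤ 0ℤ)) ×
  Σ ℕ (λ q' → (q' ℕ.≤ m) ×
    ((∀ (k : Fin m) → toℕ k ℕ.< q' → lookup j k ≡ 0ℤ) ×
     ((∀ (k : Fin m) → q' ℕ.≤ toℕ k → lookup j k < 0ℤ) ×
      (∀ (k l : Fin m) → q' ℕ.≤ toℕ k → toℕ k ℕ.< toℕ l → lookup j l < lookup j k))))

record S (n r : ℕ) : Set where
  constructor mkS
  field
    left     : Vec ℤ r
    right    : Vec ℤ (n ∸ r)
    leftOK   : LeftOK r left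
    rightOK  : RightOK (n ∸ r) right
open S public

_≈S_ : ∀ {n r} → S n r → S n r → Set
x ≈S y = (left x ≡ left y) × (right x ≡ right y)

_≤S_ : ∀ {n r} → S n r → S n r → Set
_≤S_ {n} {r} x y =
  (∀ (k : Fin r) → lookup (left x) k ≤ lookup (left y) k) ×
  (∀ (k : Fin (n ∸ r)) → lookup (right x) k ≤ lookup (right y) k)

-- Isomorphism of the (lattice) posets: an order isomorphism
-- (a surjective order embedding) w.r.t. string equality.

Iso : (n r n' r' : ℕ) → Set
Iso n r n' r' = ∃ λ (f : S n r → S n' r') →
  IsOrderIsomorphism (_≈S_ {n} {r}) (_≈S_ {n'} {r'}) (_≤S_ {n} {r}) (_≤S_ {n'} {r'}) f

-- The left block of an element of S(n,r) lists a subset A ⊆ {1,…,r} in decreasing order,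
-- padded with 0^§; the right block lists a subset B ⊆ {1,…,n-r}, negated and read backwards.
-- The componentwise order compares the sorted subsets entry by entry (reversed for B), and
-- complementation in {1,…,k} reverses that order and is an involution. Hence (A, B) ↦ (Bᶜ, Aᶜ)
-- is an order isomorphism S(n,r) ≅ S(n,n-r). Complements are computed on shifted diagrams
-- inside the staircase (k, …, 1), turned by a half-turn, where both facts become local
-- statements about cells.
module Submission where

open import Data.Empty using (⊥-elim)
open import Data.Fin using (Fin; toℕ; fromℕ<) renaming (zero to fzero; suc to fsuc)
open import Data.Fin.Properties using (toℕ<n; toℕ-fromℕ<)
open import Data.Integer as ℤ using (ℤ; +_; -_; 0ℤ; ∣_∣; -[1+_]; +≤+; +<+)
import Data.Integer.Properties as ℤₚ
open import Data.Nat using (ℕ; zero; suc; pred; _+_; _∸_; _≤_; _<_; _≤?_; _<?_; z≤n; s≤s; s≤s⁻¹)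
open import Data.Nat.Properties
open import Data.Product using (_×_; _,_; proj₁; proj₂; ∃)
open import Data.Sum using (inj₁; inj₂)
open import Data.Vec using (Vec; []; _∷_; lookup; tabulate)
open import Data.Vec.Properties using (lookup∘tabulate; tabulate∘lookup; tabulate-cong)
open import Level using (0ℓ)
open import Relation.Binary.PropositionalEquality
open import Relation.Nullary using (yes; no)
open import Relation.Unary using (Pred; Decidable)

open import Defs

prefixLength : {P : Pred ℕ 0ℓ} → Decidable P → ℕ → ℕ
prefixLength P? zero = 0
prefixLength P? (suc N) with P? 0
... | yes _ = suc (prefixLength (λ d → P? (suc d)) N)
... | no _ = 0

prefixLength≤ : ∀ {P} (P? : Decidable P) N → prefixLength P? N ≤ N
prefixLength≤ P? zero = z≤n
prefixLength≤ P? (suc N) with P? 0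
... | yes _ = s≤s (prefixLength≤ (λ d → P? (suc d)) N)
... | no _ = z≤n

<prefixLength⇒ : ∀ {P} (P? : Decidable P) N e → e < prefixLength P? N →
                 e < N × (∀ d → d ≤ e → P d)
<prefixLength⇒ P? (suc N) e e< with P? 0
<prefixLength⇒ P? (suc N) zero _ | yes P0 = s≤s z≤n , λ { zero _ → P0 }
<prefixLength⇒ P? (suc N) (suc e) e< | yes P0
  with <prefixLength⇒ (λ d → P? (suc d)) N e (s≤s⁻¹ e<)
... | e<N , P≤e = s≤s e<N , λ { zero _ → P0 ; (suc d) d≤e → P≤e d (s≤s⁻¹ d≤e) }

<prefixLength⇐ : ∀ {P} (P? : Decidable P) N e → e < N → (∀ d → d ≤ e → P d) →
                 e < prefixLength P? N
<prefixLength⇐ P? (suc N) e e<N P≤e with P? 0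
... | no ¬P0 = ⊥-elim (¬P0 (P≤e 0 z≤n))
<prefixLength⇐ P? (suc N) zero e<N P≤e | yes _ = s≤s z≤n
<prefixLength⇐ P? (suc N) (suc e) e<N P≤e | yes _ =
  s≤s (<prefixLength⇐ (λ d → P? (suc d)) N e (s≤s⁻¹ e<N) (λ d d≤e → P≤e (suc d) (s≤s d≤e)))

prefixLength-mono : ∀ {P Q} (P? : Decidable P) (Q? : Decidable Q) N →
                    (∀ d → d < N → P d → Q d) → prefixLength P? N ≤ prefixLength Q? N
prefixLength-mono P? Q? zero P⇒Q = z≤n
prefixLength-mono P? Q? (suc N) P⇒Q with P? 0 | Q? 0
... | no _ | _ = z≤n
... | yes P0 | no ¬Q0 = ⊥-elim (¬Q0 (P⇒Q 0 (s≤s z≤n) P0))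
... | yes _ | yes _ =
  s≤s (prefixLength-mono (λ d → P? (suc d)) (λ d → Q? (suc d)) N (λ d d<N → P⇒Q (suc d) (s≤s d<N)))

-- Shifted diagrams in the staircase

mirror : ℕ → ℕ → ℕ
mirror k a = k ∸ suc a

mirror< : ∀ {k a} → a < k → mirror k a < k
mirror< {suc k} {a} _ = s≤s (m∸n≤m k a)

mirror-involutive : ∀ {k a} → a < k → mirror k (mirror k a) ≡ a
mirror-involutive {k} {a} a<k = begin
  k ∸ suc (k ∸ suc a)     ≡⟨ pred[m∸n]≡m∸[1+n] k (k ∸ suc a) ⟨
  pred (k ∸ (k ∸ suc a))  ≡⟨ cong pred (m∸[m∸n]≡n a<k) ⟩
  a                       ∎
  where open ≡-Reasoning

m∸n≡1+[m∸1+n] : ∀ {m n} → n < m → m ∸ n ≡ suc (m ∸ suc n)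
m∸n≡1+[m∸1+n] {suc m} {zero} _ = refl
m∸n≡1+[m∸1+n] {suc m} {suc n} n<m = m∸n≡1+[m∸1+n] (s≤s⁻¹ n<m)

1+m+n+o∸1+n∸m≡o : ∀ m n o → suc m + n + o ∸ suc n ∸ m ≡ o
1+m+n+o∸1+n∸m≡o m n o rewrite +-comm m n | +-assoc n m o | m+n∸m≡n n (m + o) = m+n∸m≡n m o

-- The half-turn of the shifted staircase of size k maps the cell in row a, column a + e
-- to the cell in row b, column b + e, where b = k - 1 - a - e.
mirror-antidiagonal : ∀ {k a e} → a < k → e < k ∸ a →
  let b = mirror k a ∸ e in b < k × e < k ∸ b × mirror k b ∸ e ≡ a
mirror-antidiagonal {k} {a} {e} a<k e<k∸a
  with m≤n⇒∃[o]m+o≡n (m≤o∸n⇒m+n≤o (suc e) (<⇒≤ a<k) e<k∸a)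
... | t , refl rewrite 1+m+n+o∸1+n∸m≡o e a t = s≤s (m≤n+m t (e + a)) , e<k∸t , k∸1+t∸e≡a
  where
  e<k∸t : e < suc e + a + t ∸ t
  e<k∸t rewrite m+n∸n≡m (suc e + a) t = s≤s (m≤m+n e a)
  k∸1+t∸e≡a : suc e + a + t ∸ suc t ∸ e ≡ a
  k∸1+t∸e≡a rewrite +-assoc e a t | +-comm a t | sym (+-assoc e t a) = 1+m+n+o∸1+n∸m≡o e t a

-- g 0, g 1, …, g (k - 1) lists a subset of {1, …, k} in decreasing order, padded with zeros;
-- equivalently, the row lengths of a shifted diagram inside the staircase (k, k - 1, …, 1).
record IsShape (k : ℕ) (g : ℕ → ℕ) : Set where
  field
    bounded    : ∀ a → a < k → g a ≤ k
    decreasing : ∀ a → suc a < k → 0 < g (suc a) → g (suc a) < g a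
open IsShape

shape-decreasing : ∀ {k g} → IsShape k g → ∀ {a b} → a < b → b < k → 0 < g b → g b < g a
shape-decreasing sh {a} {suc b} a<1+b 1+b<k 0<g[1+b] with m≤n⇒m<n∨m≡n (s≤s⁻¹ a<1+b)
... | inj₂ refl = decreasing sh a 1+b<k 0<g[1+b]
... | inj₁ a<b  = <-trans step (shape-decreasing sh a<b (<-trans (n<1+n b) 1+b<k) (<-trans 0<g[1+b] step))
  where step = decreasing sh b 1+b<k 0<g[1+b]

shape-fits : ∀ {k g} → IsShape k g → ∀ {a} → a < k → g a + a ≤ k
shape-fits sh {zero} 0<k = ≤-trans (≤-reflexive (+-identityʳ _)) (bounded sh 0 0<k)
shape-fits {k} {g} sh {suc a} 1+a<k with g (suc a) in eq
... | zero  = <⇒≤ 1+a<k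
... | suc x = begin
  suc x + suc a   ≡⟨ +-suc (suc x) a ⟩
  suc (suc x + a) ≤⟨ +-monoˡ-≤ a (subst (_< g a) eq (decreasing sh a 1+a<k (subst (0 <_) (sym eq) (s≤s z≤n)))) ⟩
  g a + a         ≤⟨ shape-fits sh (<-trans (n<1+n a) 1+a<k) ⟩
  k               ∎
  where open ≤-Reasoning

positiveLength : ℕ → (ℕ → ℕ) → ℕ
positiveLength k g = prefixLength (λ a → 0 <? g a) k

<positiveLength⇒positive : ∀ k g {a} → a < positiveLength k g → 0 < g a
<positiveLength⇒positive k g {a} a<p = proj₂ (<prefixLength⇒ (λ a → 0 <? g a) k a a<p) a ≤-refl

positiveLength≤⇒zero : ∀ {k g} → IsShape k g → ∀ {a} → a < k → positiveLength k g ≤ a → g a ≡ 0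
positiveLength≤⇒zero {k} {g} sh {a} a<k p≤a with g a in eq
... | zero  = refl
... | suc _ = ⊥-elim (<⇒≱ (<prefixLength⇐ (λ a → 0 <? g a) k a a<k positive-below) p≤a)
  where
  0<ga : 0 < g a
  0<ga = subst (0 <_) (sym eq) (s≤s z≤n)
  positive-below : ∀ d → d ≤ a → 0 < g d
  positive-below d d≤a with m≤n⇒m<n∨m≡n d≤a
  ... | inj₂ refl = 0<ga
  ... | inj₁ d<a  = <-trans 0<ga (shape-decreasing sh d<a a<k 0<ga)

∸-1+-comm : ∀ m n o → m ∸ n ∸ suc o ≡ m ∸ suc n ∸ o
∸-1+-comm m n o = begin
  m ∸ n ∸ suc o   ≡⟨ ∸-+-assoc m n (suc o) ⟩
  m ∸ (n + suc o) ≡⟨ cong (m ∸_) (+-suc n o) ⟩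
  m ∸ suc (n + o) ≡⟨ ∸-+-assoc m (suc n) o ⟨
  m ∸ suc n ∸ o   ∎
  where open ≡-Reasoning

<-cover⇒≤ : ∀ {m n} → (∀ e → e < m → e < n) → m ≤ n
<-cover⇒≤ {zero}  _     = z≤n
<-cover⇒≤ {suc m} cover = cover m ≤-refl

_≤[_]_ : (ℕ → ℕ) → ℕ → (ℕ → ℕ) → Set
g ≤[ k ] h = ∀ a → a < k → g a ≤ h a

_≗[_]_ : (ℕ → ℕ) → ℕ → (ℕ → ℕ) → Set
g ≗[ k ] h = ∀ a → a < k → g a ≡ h a

-- Complementation

-- Row a of the complement of the diagram of g, turned by a half-turn: its cell in column
-- a + e is kept iff the rotated cell lies outside the diagram of g (see mirror-antidiagonal).
-- On the subsets of {1, …, k} encoded by shapes this is set complement.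
complement : ℕ → (ℕ → ℕ) → ℕ → ℕ
complement k g a = prefixLength (λ e → g (mirror k a ∸ e) ≤? e) (k ∸ a)

<complement⇒ : ∀ {k g a e} → e < complement k g a → e < k ∸ a × g (mirror k a ∸ e) ≤ e
<complement⇒ {k} {g} {a} {e} e<c with <prefixLength⇒ (λ e → g (mirror k a ∸ e) ≤? e) (k ∸ a) e e<c
... | e<k∸a , outside = e<k∸a , outside e ≤-refl

-- The right ends a + g a of the nonzero rows of a shifted diagram weakly decrease, so a cell
-- outside the diagram stays outside when moved down a row.
outside-step : ∀ {k g} → IsShape k g → ∀ {c e} → suc e ≤ c → c < k →
               g (c ∸ suc e) ≤ suc e → g (c ∸ e) ≤ e
outside-step {k} {g} sh {c} {e} e<c c<k outside rewrite m∸n≡1+[m∸1+n] e<c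
  with g (suc (c ∸ suc e)) in eq
... | zero  = z≤n
... | suc x = s≤s⁻¹ (≤-trans (subst (_< g (c ∸ suc e)) eq
                                 (decreasing sh (c ∸ suc e) 1+c∸1+e<k (subst (0 <_) (sym eq) (s≤s z≤n))))
                              outside)
  where
  1+c∸1+e<k : suc (c ∸ suc e) < k
  1+c∸1+e<k = ≤-<-trans (subst (_≤ c) (m∸n≡1+[m∸1+n] e<c) (m∸n≤m c e)) c<k

outside-closed : ∀ {k g} → IsShape k g → ∀ {c e} → e ≤ c → c < k →
                 g (c ∸ e) ≤ e → ∀ d → d ≤ e → g (c ∸ d) ≤ d
outside-closed sh {e = e} e≤c c<k outside d d≤e with m≤n⇒m<n∨m≡n d≤e
... | inj₂ refl = outside
outside-closed sh {e = suc e} e<c c<k outside d d≤e | inj₁ d<1+e =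
  outside-closed sh (≤-trans (n≤1+n e) e<c) c<k (outside-step sh e<c c<k outside) d (s≤s⁻¹ d<1+e)

<complement⇐ : ∀ {k g} → IsShape k g → ∀ {a e} → a < k → e < k ∸ a →
               g (mirror k a ∸ e) ≤ e → e < complement k g a
<complement⇐ {k} {g} sh {a} {e} a<k e<k∸a outside =
  <prefixLength⇐ (λ e → g (mirror k a ∸ e) ≤? e) (k ∸ a) e e<k∸a
    (outside-closed sh e≤mirror (mirror< a<k) outside)
  where
  e≤mirror : e ≤ mirror k a
  e≤mirror = s≤s⁻¹ (subst (e <_) (m∸n≡1+[m∸1+n] a<k) e<k∸a)

complement-isShape : ∀ {k g} → IsShape k g → IsShape k (complement k g)
complement-isShape {k} {g} sh = record
  { bounded    = λ a _ → ≤-trans (prefixLength≤ _ (k ∸ a)) (m∸n≤m k a)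
  ; decreasing = decreasing′
  }
  where
  decreasing′ : ∀ a → suc a < k → 0 < complement k g (suc a) → complement k g (suc a) < complement k g a
  decreasing′ a 1+a<k _ with complement k g (suc a) in eq
  ... | suc x with <complement⇒ {k} {g} {suc a} {x} (subst (x <_) (sym eq) ≤-refl)
  ... | x<k∸1+a , outside =
    <complement⇐ sh a<k (subst (suc x <_) (sym (m∸n≡1+[m∸1+n] a<k)) (s≤s x<k∸1+a))
      (subst (λ i → g i ≤ suc x) (sym (∸-1+-comm k (suc a) x)) (m≤n⇒m≤1+n outside))
    where
    a<k : a < k
    a<k = <-trans (n<1+n a) 1+a<k

complement-antitone : ∀ {k} g h → g ≤[ k ] h → complement k h ≤[ k ] complement k g
complement-antitone {k} g h g≤h a a<k = prefixLength-mono _ _ (k ∸ a)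
  (λ e _ h≤e → ≤-trans (g≤h _ (≤-<-trans (m∸n≤m _ e) (mirror< a<k))) h≤e)

complement-cong : ∀ {k} g h → g ≗[ k ] h → complement k g ≗[ k ] complement k h
complement-cong g h g≗h a a<k = ≤-antisym
  (complement-antitone h g (λ b b<k → ≤-reflexive (sym (g≗h b b<k))) a a<k)
  (complement-antitone g h (λ b b<k → ≤-reflexive (g≗h b b<k)) a a<k)

-- A cell lies in the doubly complemented diagram iff its half-turn image lies outside the
-- complemented one, i.e. iff the cell lies in the diagram of g.
complement-involutive : ∀ {k g} → IsShape k g → complement k (complement k g) ≗[ k ] g
complement-involutive {k} {g} sh a a<k = ≤-antisym (<-cover⇒≤ ⊆g) (<-cover⇒≤ g⊆)
  where
  g′ = complement k g
  ⊆g : ∀ e → e < complement k g′ a → e < g a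
  ⊆g e e<c with <complement⇒ {k} {g′} {a} {e} e<c
  ... | e<k∸a , g′b≤e with mirror-antidiagonal a<k e<k∸a | g a ≤? e
  ... | _ | no ga≰e = ≰⇒> ga≰e
  ... | b<k , e<k∸b , mirror-b≡a | yes ga≤e =
    ⊥-elim (<⇒≱ (<complement⇐ sh b<k e<k∸b (subst (λ i → g i ≤ e) (sym mirror-b≡a) ga≤e)) g′b≤e)
  g⊆ : ∀ e → e < g a → e < complement k g′ a
  g⊆ e e<ga = <complement⇐ (complement-isShape sh) a<k e<k∸a g′b≤e
    where
    e<k∸a : e < k ∸ a
    e<k∸a = <-≤-trans e<ga (m+n≤o⇒m≤o∸n (g a) (shape-fits sh a<k))
    g′b≤e : g′ (mirror k a ∸ e) ≤ e
    g′b≤e with g′ (mirror k a ∸ e) ≤? e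
    ... | yes g′b≤e = g′b≤e
    ... | no g′b≰e with mirror-antidiagonal a<k e<k∸a
    ... | _ , _ , mirror-b≡a = ⊥-elim (<⇒≱ e<ga
           (subst (λ i → g i ≤ e) mirror-b≡a (proj₂ (<complement⇒ {k} {g} (≰⇒> g′b≰e)))))

-- Blocks of S(n,r) as shapes

i≤0⇒-+∣i∣≡i : ∀ {i} → i ℤ.≤ 0ℤ → - (+ ∣ i ∣) ≡ i
i≤0⇒-+∣i∣≡i {+ zero}   _ = refl
i≤0⇒-+∣i∣≡i { -[1+ _ ]} _ = refl
i≤0⇒-+∣i∣≡i {+ suc _}  (+≤+ ())

-- Out of range the value is the junk 0ℤ.
lookupℕ : ∀ {k} → Vec ℤ k → ℕ → ℤ
lookupℕ []      _       = 0ℤ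
lookupℕ (x ∷ _) zero    = x
lookupℕ (_ ∷ v) (suc a) = lookupℕ v a

lookupℕ-toℕ : ∀ {k} (v : Vec ℤ k) (i : Fin k) → lookupℕ v (toℕ i) ≡ lookup v i
lookupℕ-toℕ (_ ∷ _) fzero    = refl
lookupℕ-toℕ (_ ∷ v) (fsuc i) = lookupℕ-toℕ v i

lookupℕ-fromℕ< : ∀ {k a} (v : Vec ℤ k) (a<k : a < k) → lookupℕ v a ≡ lookup v (fromℕ< a<k)
lookupℕ-fromℕ< v a<k = trans (cong (lookupℕ v) (sym (toℕ-fromℕ< a<k))) (lookupℕ-toℕ v (fromℕ< a<k))

∀Fin⇒∀< : ∀ {k} (P : ℕ → Set) → (∀ (i : Fin k) → P (toℕ i)) → ∀ a → a < k → P a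
∀Fin⇒∀< P P-at a a<k = subst P (toℕ-fromℕ< a<k) (P-at (fromℕ< a<k))

_≤ᵛ_ : ∀ {k} → Vec ℤ k → Vec ℤ k → Set
u ≤ᵛ v = ∀ i → lookup u i ℤ.≤ lookup v i

≤ᵛ-antisym : ∀ {k} {u v : Vec ℤ k} → u ≤ᵛ v → v ≤ᵛ u → u ≡ v
≤ᵛ-antisym {u = u} {v} u≤v v≤u = begin
  u                ≡⟨ tabulate∘lookup u ⟨
  tabulate (lookup u) ≡⟨ tabulate-cong (λ i → ℤₚ.≤-antisym (u≤v i) (v≤u i)) ⟩
  tabulate (lookup v) ≡⟨ tabulate∘lookup v ⟩
  v                ∎
  where open ≡-Reasoning

≡⇒≤ᵛ : ∀ {k} {u v : Vec ℤ k} → u ≡ v → u ≤ᵛ v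
≡⇒≤ᵛ refl i = ℤₚ.≤-refl

encodeLeft : (k : ℕ) → (ℕ → ℕ) → Vec ℤ k
encodeLeft k g = tabulate (λ i → + g (toℕ i))

encodeRight : (k : ℕ) → (ℕ → ℕ) → Vec ℤ k
encodeRight k g = tabulate (λ i → - (+ g (mirror k (toℕ i))))

leftShape : ∀ {k} → Vec ℤ k → ℕ → ℕ
leftShape v a = ∣ lookupℕ v a ∣

rightShape : ∀ {k} → Vec ℤ k → ℕ → ℕ
rightShape {k} w a = ∣ lookupℕ w (mirror k a) ∣

lookup-encodeLeft : ∀ {k a} g (a<k : a < k) → lookupℕ (encodeLeft k g) a ≡ + g a
lookup-encodeLeft {k} g a<k = trans (lookupℕ-fromℕ< (encodeLeft k g) a<k)
  (trans (lookup∘tabulate _ (fromℕ< a<k)) (cong (λ a → + g a) (toℕ-fromℕ< a<k)))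

lookup-encodeRight : ∀ {k a} g (a<k : a < k) → lookupℕ (encodeRight k g) a ≡ - (+ g (mirror k a))
lookup-encodeRight {k} g a<k = trans (lookupℕ-fromℕ< (encodeRight k g) a<k)
  (trans (lookup∘tabulate _ (fromℕ< a<k)) (cong (λ a → - (+ g (mirror k a))) (toℕ-fromℕ< a<k)))

leftShape-encodeLeft : ∀ {k} g → leftShape (encodeLeft k g) ≗[ k ] g
leftShape-encodeLeft g a a<k = cong ∣_∣ (lookup-encodeLeft g a<k)

rightShape-encodeRight : ∀ {k} g → rightShape (encodeRight k g) ≗[ k ] g
rightShape-encodeRight {k} g a a<k = begin
  ∣ lookupℕ (encodeRight k g) (mirror k a) ∣   ≡⟨ cong ∣_∣ (lookup-encodeRight g (mirror< a<k)) ⟩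
  ∣ - (+ g (mirror k (mirror k a))) ∣          ≡⟨ ℤₚ.∣-i∣≡∣i∣ (+ _) ⟩
  g (mirror k (mirror k a))                    ≡⟨ cong g (mirror-involutive a<k) ⟩
  g a                                          ∎
  where open ≡-Reasoning

encodeLeft-cong : ∀ {k g h} → g ≗[ k ] h → encodeLeft k g ≡ encodeLeft k h
encodeLeft-cong g≗h = tabulate-cong (λ i → cong +_ (g≗h (toℕ i) (toℕ<n i)))

encodeRight-cong : ∀ {k g h} → g ≗[ k ] h → encodeRight k g ≡ encodeRight k h
encodeRight-cong g≗h = tabulate-cong (λ i → cong (λ x → - (+ x)) (g≗h _ (mirror< (toℕ<n i))))

encodeLeft-mono : ∀ {k} g h → g ≤[ k ] h → encodeLeft k g ≤ᵛ encodeLeft k h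
encodeLeft-mono g h g≤h i
  rewrite lookup∘tabulate (λ i → + g (toℕ i)) i | lookup∘tabulate (λ i → + h (toℕ i)) i =
  +≤+ (g≤h (toℕ i) (toℕ<n i))

encodeLeft-cancel : ∀ {k} g h → encodeLeft k g ≤ᵛ encodeLeft k h → g ≤[ k ] h
encodeLeft-cancel g h gᵛ≤hᵛ = ∀Fin⇒∀< (λ a → g a ≤ h a) λ i →
  ℤₚ.drop‿+≤+ (subst₂ ℤ._≤_ (lookup∘tabulate _ i) (lookup∘tabulate _ i) (gᵛ≤hᵛ i))

encodeRight-antitone : ∀ {k} g h → h ≤[ k ] g → encodeRight k g ≤ᵛ encodeRight k h
encodeRight-antitone {k} g h h≤g i
  rewrite lookup∘tabulate (λ i → - (+ g (mirror k (toℕ i)))) i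
        | lookup∘tabulate (λ i → - (+ h (mirror k (toℕ i)))) i =
  ℤₚ.neg-mono-≤ (+≤+ (h≤g _ (mirror< (toℕ<n i))))

encodeRight-cancel : ∀ {k} g h → encodeRight k g ≤ᵛ encodeRight k h → h ≤[ k ] g
encodeRight-cancel {k} g h gᵛ≤hᵛ a a<k = subst (λ b → h b ≤ g b) (mirror-involutive a<k)
  (∀Fin⇒∀< (λ b → h (mirror k b) ≤ g (mirror k b))
    (λ i → ℤₚ.drop‿+≤+ (ℤₚ.neg-cancel-≤
      (subst₂ ℤ._≤_ (lookup∘tabulate _ i) (lookup∘tabulate _ i) (gᵛ≤hᵛ i))))
    (mirror k a) (mirror< a<k))

leftOK⇒encode : ∀ {k} v → LeftOK k v → v ≡ encodeLeft k (leftShape v)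
leftOK⇒encode {k} v (bounds , _) = begin
  v                          ≡⟨ tabulate∘lookup v ⟨
  tabulate (lookup v)        ≡⟨ tabulate-cong entry ⟩
  encodeLeft k (leftShape v) ∎
  where
  open ≡-Reasoning
  entry : ∀ i → lookup v i ≡ + ∣ lookupℕ v (toℕ i) ∣
  entry i = sym (trans (cong (λ x → + ∣ x ∣) (lookupℕ-toℕ v i)) (ℤₚ.0≤i⇒+∣i∣≡i (proj₁ (bounds i))))

rightOK⇒encode : ∀ {k} w → RightOK k w → w ≡ encodeRight k (rightShape w)
rightOK⇒encode {k} w (bounds , _) = begin
  w                            ≡⟨ tabulate∘lookup w ⟨
  tabulate (lookup w)          ≡⟨ tabulate-cong entry ⟩
  encodeRight k (rightShape w) ∎
  where
  open ≡-Reasoning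
  entry : ∀ i → lookup w i ≡ - (+ ∣ lookupℕ w (mirror k (mirror k (toℕ i))) ∣)
  entry i = sym (begin
    - (+ ∣ lookupℕ w (mirror k (mirror k (toℕ i))) ∣)
      ≡⟨ cong (λ a → - (+ ∣ lookupℕ w a ∣)) (mirror-involutive (toℕ<n i)) ⟩
    - (+ ∣ lookupℕ w (toℕ i) ∣)
      ≡⟨ cong (λ x → - (+ ∣ x ∣)) (lookupℕ-toℕ w i) ⟩
    - (+ ∣ lookup w i ∣)
      ≡⟨ i≤0⇒-+∣i∣≡i (proj₂ (bounds i)) ⟩
    lookup w i ∎)

leftOK⇒isShape : ∀ {k} v → LeftOK k v → IsShape k (leftShape v)
leftOK⇒isShape {k} v (bounds , p , _ , _ , dec , zero-from) = record
  { bounded    = ∀Fin⇒∀< (λ a → leftShape v a ≤ k) bounded-at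
  ; decreasing = decreasing′
  }
  where
  +∣v∣≡v : ∀ i → + ∣ lookup v i ∣ ≡ lookup v i
  +∣v∣≡v i = ℤₚ.0≤i⇒+∣i∣≡i (proj₁ (bounds i))
  bounded-at : ∀ i → leftShape v (toℕ i) ≤ k
  bounded-at i rewrite lookupℕ-toℕ v i =
    ℤₚ.drop‿+≤+ (subst (ℤ._≤ + k) (sym (+∣v∣≡v i)) (proj₂ (bounds i)))
  decreasing′ : ∀ a → suc a < k → 0 < leftShape v (suc a) → leftShape v (suc a) < leftShape v a
  decreasing′ a 1+a<k 0<v[1+a]
    rewrite lookupℕ-fromℕ< v 1+a<k | lookupℕ-fromℕ< v (<-trans (n<1+n a) 1+a<k)
    with suc a <? p
  ... | yes 1+a<p = ℤₚ.drop‿+<+ (subst₂ ℤ._<_ (sym (+∣v∣≡v j)) (sym (+∣v∣≡v i))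
          (dec i j (subst₂ _<_ (sym (toℕ-fromℕ< _)) (sym (toℕ-fromℕ< 1+a<k)) (n<1+n a))
                   (subst (_< p) (sym (toℕ-fromℕ< 1+a<k)) 1+a<p)))
    where
    i = fromℕ< (<-trans (n<1+n a) 1+a<k)
    j = fromℕ< 1+a<k
  ... | no 1+a≮p = ⊥-elim (<-irrefl refl
          (subst (λ x → 0 < ∣ x ∣)
                 (zero-from _ (subst (p ≤_) (sym (toℕ-fromℕ< 1+a<k)) (≮⇒≥ 1+a≮p))) 0<v[1+a]))

rightOK⇒isShape : ∀ {k} w → RightOK k w → IsShape k (rightShape w)
rightOK⇒isShape {k} w (bounds , q , _ , zero-below , _ , dec) = record
  { bounded    = λ a a<k → ∀Fin⇒∀< (λ b → ∣ lookupℕ w b ∣ ≤ k) bounded-at (mirror k a) (mirror< a<k)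
  ; decreasing = decreasing′
  }
  where
  -+∣w∣≡w : ∀ i → - (+ ∣ lookup w i ∣) ≡ lookup w i
  -+∣w∣≡w i = i≤0⇒-+∣i∣≡i (proj₂ (bounds i))
  bounded-at : ∀ i → ∣ lookupℕ w (toℕ i) ∣ ≤ k
  bounded-at i rewrite lookupℕ-toℕ w i =
    ℤₚ.drop‿+≤+ (ℤₚ.neg-cancel-≤ (subst (- (+ k) ℤ.≤_) (sym (-+∣w∣≡w i)) (proj₁ (bounds i))))
  step : ∀ b → suc b < k → 0 < ∣ lookupℕ w b ∣ → ∣ lookupℕ w b ∣ < ∣ lookupℕ w (suc b) ∣
  step b 1+b<k 0<w[b]
    rewrite lookupℕ-fromℕ< w 1+b<k | lookupℕ-fromℕ< w (<-trans (n<1+n b) 1+b<k)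
    with b <? q
  ... | yes b<q = ⊥-elim (<-irrefl refl
          (subst (λ x → 0 < ∣ x ∣) (zero-below _ (subst (_< q) (sym (toℕ-fromℕ< _)) b<q)) 0<w[b]))
  ... | no b≮q = ℤₚ.drop‿+<+ (ℤₚ.neg-cancel-< (subst₂ ℤ._<_ (sym (-+∣w∣≡w j)) (sym (-+∣w∣≡w i))
          (dec i j (subst (q ≤_) (sym (toℕ-fromℕ< _)) (≮⇒≥ b≮q))
                   (subst₂ _<_ (sym (toℕ-fromℕ< _)) (sym (toℕ-fromℕ< 1+b<k)) (n<1+n b)))))
    where
    i = fromℕ< (<-trans (n<1+n b) 1+b<k)
    j = fromℕ< 1+b<k
  decreasing′ : ∀ a → suc a < k → 0 < rightShape w (suc a) → rightShape w (suc a) < rightShape w a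
  decreasing′ a 1+a<k 0<w[b] =
    subst (λ c → rightShape w (suc a) < ∣ lookupℕ w c ∣) (sym mirror≡1+mirror)
      (step (mirror k (suc a)) (subst (_< k) mirror≡1+mirror (mirror< (<-trans (n<1+n a) 1+a<k))) 0<w[b])
    where
    mirror≡1+mirror : mirror k a ≡ suc (mirror k (suc a))
    mirror≡1+mirror = m∸n≡1+[m∸1+n] 1+a<k

isShape⇒leftOK : ∀ {k g} → IsShape k g → LeftOK k (encodeLeft k g)
isShape⇒leftOK {k} {g} sh =
  entries , positiveLength k g , prefixLength≤ _ k , positive , decreasing′ , zero-from
  where
  p = positiveLength k g
  entry : ∀ i → lookup (encodeLeft k g) i ≡ + g (toℕ i)
  entry = lookup∘tabulate _
  entries : ∀ i → (0ℤ ℤ.≤ lookup (encodeLeft k g) i) × (lookup (encodeLeft k g) i ℤ.≤ + k)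
  entries i rewrite entry i = +≤+ z≤n , +≤+ (bounded sh (toℕ i) (toℕ<n i))
  positive : ∀ i → toℕ i < p → 0ℤ ℤ.< lookup (encodeLeft k g) i
  positive i i<p rewrite entry i = +<+ (<positiveLength⇒positive k g i<p)
  decreasing′ : ∀ i j → toℕ i < toℕ j → toℕ j < p → lookup (encodeLeft k g) j ℤ.< lookup (encodeLeft k g) i
  decreasing′ i j i<j j<p rewrite entry i | entry j =
    +<+ (shape-decreasing sh i<j (toℕ<n j) (<positiveLength⇒positive k g j<p))
  zero-from : ∀ i → p ≤ toℕ i → lookup (encodeLeft k g) i ≡ 0ℤ
  zero-from i p≤i rewrite entry i = cong +_ (positiveLength≤⇒zero sh (toℕ<n i) p≤i)

isShape⇒rightOK : ∀ {k g} → IsShape k g → RightOK k (encodeRight k g)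
isShape⇒rightOK {k} {g} sh =
  entries , k ∸ p , m∸n≤m k p , zero-below , negative , decreasing′
  where
  p = positiveLength k g
  entry : ∀ i → lookup (encodeRight k g) i ≡ - (+ g (mirror k (toℕ i)))
  entry = lookup∘tabulate _
  mirror<p : ∀ {b} → k ∸ p ≤ b → b < k → mirror k b < p
  mirror<p {b} k∸p≤b b<k with p ≤? mirror k b
  ... | no p≰mirror = ≰⇒> p≰mirror
  ... | yes p≤mirror = ⊥-elim (<⇒≱
          (m+n≤o⇒m≤o∸n (suc b) (subst (_≤ k) (+-comm p (suc b)) (m≤o∸n⇒m+n≤o p b<k p≤mirror))) k∸p≤b)
  positive : ∀ i → k ∸ p ≤ toℕ i → 0 < g (mirror k (toℕ i))
  positive i k∸p≤i = <positiveLength⇒positive k g (mirror<p k∸p≤i (toℕ<n i))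
  entries : ∀ i → (- (+ k) ℤ.≤ lookup (encodeRight k g) i) × (lookup (encodeRight k g) i ℤ.≤ 0ℤ)
  entries i rewrite entry i = ℤₚ.neg-mono-≤ (+≤+ (bounded sh _ (mirror< (toℕ<n i)))) , ℤₚ.neg-≤-pos
  zero-below : ∀ i → toℕ i < k ∸ p → lookup (encodeRight k g) i ≡ 0ℤ
  zero-below i i<k∸p rewrite entry i =
    cong (λ x → - (+ x)) (positiveLength≤⇒zero sh (mirror< (toℕ<n i)) (m+n≤o⇒m≤o∸n p
      (subst (_≤ k) (+-comm (suc (toℕ i)) p) (m≤o∸n⇒m+n≤o (suc (toℕ i)) (prefixLength≤ _ k) i<k∸p))))
  negative : ∀ i → k ∸ p ≤ toℕ i → lookup (encodeRight k g) i ℤ.< 0ℤ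
  negative i k∸p≤i rewrite entry i with g (mirror k (toℕ i)) | positive i k∸p≤i
  ... | suc _ | _ = ℤ.-<+
  decreasing′ : ∀ i j → k ∸ p ≤ toℕ i → toℕ i < toℕ j →
                lookup (encodeRight k g) j ℤ.< lookup (encodeRight k g) i
  decreasing′ i j k∸p≤i i<j rewrite entry i | entry j = ℤₚ.neg-mono-<
    (+<+ (shape-decreasing sh (∸-monoʳ-< (s≤s i<j) (toℕ<n j)) (mirror< (toℕ<n i)) (positive i k∸p≤i)))

≤ᵛ⇒leftShape≤ : ∀ {k} (u v : Vec ℤ k) → LeftOK k u → LeftOK k v →
                u ≤ᵛ v → leftShape u ≤[ k ] leftShape v
≤ᵛ⇒leftShape≤ u v u-ok v-ok u≤v =
  encodeLeft-cancel _ _ (subst₂ _≤ᵛ_ (leftOK⇒encode u u-ok) (leftOK⇒encode v v-ok) u≤v)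

leftShape≤⇒≤ᵛ : ∀ {k} (u v : Vec ℤ k) → LeftOK k u → LeftOK k v →
                leftShape u ≤[ k ] leftShape v → u ≤ᵛ v
leftShape≤⇒≤ᵛ u v u-ok v-ok u≤v =
  subst₂ _≤ᵛ_ (sym (leftOK⇒encode u u-ok)) (sym (leftOK⇒encode v v-ok)) (encodeLeft-mono _ _ u≤v)

≤ᵛ⇒rightShape≥ : ∀ {k} (u v : Vec ℤ k) → RightOK k u → RightOK k v →
                 u ≤ᵛ v → rightShape v ≤[ k ] rightShape u
≤ᵛ⇒rightShape≥ u v u-ok v-ok u≤v =
  encodeRight-cancel _ _ (subst₂ _≤ᵛ_ (rightOK⇒encode u u-ok) (rightOK⇒encode v v-ok) u≤v)

rightShape≥⇒≤ᵛ : ∀ {k} (u v : Vec ℤ k) → RightOK k u → RightOK k v →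
                 rightShape v ≤[ k ] rightShape u → u ≤ᵛ v
rightShape≥⇒≤ᵛ u v u-ok v-ok v≤u =
  subst₂ _≤ᵛ_ (sym (rightOK⇒encode u u-ok)) (sym (rightOK⇒encode v v-ok)) (encodeRight-antitone _ _ v≤u)

complement-cancel : ∀ {k g h} → IsShape k g → IsShape k h →
                    complement k g ≤[ k ] complement k h → h ≤[ k ] g
complement-cancel {k} {g} {h} g-sh h-sh g′≤h′ a a<k = subst₂ _≤_
  (complement-involutive h-sh a a<k) (complement-involutive g-sh a a<k)
  (complement-antitone (complement k g) (complement k h) g′≤h′ a a<k)

-- K = n ∸ (n ∸ r), the length of the right block of S(n,n-r), equals r only propositionally.
module Swap (n r : ℕ) (r≤n : r ≤ n) where

  private
    m = n ∸ r
    K = n ∸ (n ∸ r)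

    r≡K : r ≡ K
    r≡K = sym (m∸[m∸n]≡n r≤n)

    <r⇒<K : ∀ {a} → a < r → a < K
    <r⇒<K {a} = subst (a <_) r≡K

    <K⇒<r : ∀ {a} → a < K → a < r
    <K⇒<r {a} = subst (a <_) (sym r≡K)

    isShape-K : ∀ {g} → IsShape r g → IsShape K g
    isShape-K {g} = subst (λ k → IsShape k g) r≡K

    isShape-r : ∀ {g} → IsShape K g → IsShape r g
    isShape-r {g} = subst (λ k → IsShape k g) (sym r≡K)

  leftShapeOf rightShapeOf : S n r → ℕ → ℕ
  leftShapeOf x = leftShape (left x)
  rightShapeOf x = rightShape (right x)

  leftShapeOf-isShape : ∀ x → IsShape r (leftShapeOf x)
  leftShapeOf-isShape x = leftOK⇒isShape (left x) (leftOK x)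

  rightShapeOf-isShape : ∀ x → IsShape m (rightShapeOf x)
  rightShapeOf-isShape x = rightOK⇒isShape (right x) (rightOK x)

  swap : S n r → S n (n ∸ r)
  swap x = mkS
    (encodeLeft m (complement m (rightShapeOf x)))
    (encodeRight K (complement K (leftShapeOf x)))
    (isShape⇒leftOK (complement-isShape (rightShapeOf-isShape x)))
    (isShape⇒rightOK (complement-isShape (isShape-K (leftShapeOf-isShape x))))

  swap-cong : ∀ {x y} → x ≈S y → swap x ≈S swap y
  swap-cong (left≡ , right≡) =
    cong (λ w → encodeLeft m (complement m (rightShape w))) right≡ ,
    cong (λ v → encodeRight K (complement K (leftShape v))) left≡

  swap-mono : ∀ {x y} → x ≤S y → swap x ≤S swap y
  swap-mono {x} {y} (left≤ , right≤) =
    encodeLeft-mono _ _ (complement-antitone (rightShapeOf y) (rightShapeOf x)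
      (≤ᵛ⇒rightShape≥ (right x) (right y) (rightOK x) (rightOK y) right≤)) ,
    encodeRight-antitone _ _ (complement-antitone (leftShapeOf x) (leftShapeOf y)
      (λ a a<K → ≤ᵛ⇒leftShape≤ (left x) (left y) (leftOK x) (leftOK y) left≤ a (<K⇒<r a<K)))

  swap-cancel : ∀ {x y} → swap x ≤S swap y → x ≤S y
  swap-cancel {x} {y} (left≤ , right≤) =
    leftShape≤⇒≤ᵛ (left x) (left y) (leftOK x) (leftOK y)
      (λ a a<r → complement-cancel (isShape-K (leftShapeOf-isShape y)) (isShape-K (leftShapeOf-isShape x))
                                   (encodeRight-cancel _ _ right≤) a (<r⇒<K a<r)) ,
    rightShape≥⇒≤ᵛ (right x) (right y) (rightOK x) (rightOK y)
      (complement-cancel (rightShapeOf-isShape x) (rightShapeOf-isShape y) (encodeLeft-cancel _ _ left≤))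

  swap-injective : ∀ {x y} → swap x ≈S swap y → x ≈S y
  swap-injective {x} {y} (left≡ , right≡)
    with swap-cancel {x} {y} (≡⇒≤ᵛ left≡ , ≡⇒≤ᵛ right≡)
       | swap-cancel {y} {x} (≡⇒≤ᵛ (sym left≡) , ≡⇒≤ᵛ (sym right≡))
  ... | left≤ , right≤ | left≥ , right≥ = ≤ᵛ-antisym left≤ left≥ , ≤ᵛ-antisym right≤ right≥

  swap-surjective : ∀ y → ∃ λ x → ∀ {z} → z ≈S x → swap z ≈S y
  swap-surjective y = preimage , λ (left≡ , right≡) →
    trans (cong (λ w → encodeLeft m (complement m (rightShape w))) right≡) swap-left ,
    trans (cong (λ v → encodeRight K (complement K (leftShape v))) left≡) swap-right
    where
    g = leftShape (left y)
    h = rightShape (right y)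
    g-sh : IsShape m g
    g-sh = leftOK⇒isShape (left y) (leftOK y)
    h-sh : IsShape K h
    h-sh = rightOK⇒isShape (right y) (rightOK y)
    preimage : S n r
    preimage = mkS (encodeLeft r (complement K h)) (encodeRight m (complement m g))
      (isShape⇒leftOK (isShape-r (complement-isShape h-sh)))
      (isShape⇒rightOK (complement-isShape g-sh))
    open ≡-Reasoning
    swap-left : encodeLeft m (complement m (rightShape (encodeRight m (complement m g)))) ≡ left y
    swap-left = begin
      encodeLeft m (complement m (rightShape (encodeRight m (complement m g))))
        ≡⟨ encodeLeft-cong (complement-cong _ _ (rightShape-encodeRight (complement m g))) ⟩
      encodeLeft m (complement m (complement m g))
        ≡⟨ encodeLeft-cong (complement-involutive g-sh) ⟩
      encodeLeft m g
        ≡⟨ leftOK⇒encode (left y) (leftOK y) ⟨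
      left y ∎
    swap-right : encodeRight K (complement K (leftShape (encodeLeft r (complement K h)))) ≡ right y
    swap-right = begin
      encodeRight K (complement K (leftShape (encodeLeft r (complement K h))))
        ≡⟨ encodeRight-cong (complement-cong _ _
             (λ a a<K → leftShape-encodeLeft (complement K h) a (<K⇒<r a<K))) ⟩
      encodeRight K (complement K (complement K h))
        ≡⟨ encodeRight-cong (complement-involutive h-sh) ⟩
      encodeRight K h
        ≡⟨ rightOK⇒encode (right y) (rightOK y) ⟨
      right y ∎

mainTheorem10 : (n r : ℕ) → r ≤ n → Iso n r n (n ∸ r)
mainTheorem10 n r r≤n = swap , record
  { isOrderMonomorphism = record
    { isOrderHomomorphism = record
      { cong = λ {x} {y} → swap-cong {x} {y}
      ; mono = λ {x} {y} → swap-mono {x} {y}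
      }
    ; injective = λ {x} {y} → swap-injective {x} {y}
    ; cancel    = λ {x} {y} → swap-cancel {x} {y}
    }
  ; surjective = swap-surjective
  }
  where open Swap n r r≤n
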